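{- For every integer $\delta \geq 1$ there is an integer $k_\delta$ such that for all integers $k \geq k_\delta$ the following hold. (i) For each $r \in \{0,1,2,\dots,2\delta\}$, there is a $K_{2\delta+1}$-saturated graph with $3\delta k + r$ vertices that is $[(3\delta-2)k + (r-1)]$-regular. (ii) For each $r \in \{1,2,\dots,2\delta+1\}$, there is a $K_{2\delta+2}$-saturated graph with $(3\delta+2)k + r$ vertices that is $[3\delta k + (r-1)]$-regular.
   Context: All graphs are finite and simple. For a graph $F$, a graph $G$ is $F$-saturated if $G$ contains no subgraph isomorphic to $F$, but adding any edge between two nonadjacent vertices of $G$ creates a subgraph isomorphic to $F$. A graph is $d$-regular if every vertex has degree $d$. $K_s$ denotes the complete graph on $s$ vertices. -}

module Defs where

open import Data.Nat using (ℕ; zero; suc; _+_; _*_; _≤_)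
open import Data.Bool using (Bool; true; false)
open import Data.Fin using (Fin)
open import Data.List using (List; filter; length; allFin)
open import Data.Product using (Σ; _×_; ∃-syntax)
open import Data.Sum using (_⊎_)
open import Function.Definitions using (Injective)
open import Relation.Binary.PropositionalEquality using (_≡_; _≢_)
open import Relation.Nullary using (¬_)
open import Relation.Nullary.Decidable using (does)
open import Data.Bool using (T)

record Graph (n : ℕ) : Set where
  field
    adj   : Fin n → Fin n → Bool
    sym   : ∀ u v → adj u v ≡ adj v u
    irrefl : ∀ v → adj v v ≡ false
open Graph public

Adj : ∀ {n} → Graph n → Fin n → Fin n → Set
Adj G u v = T (adj G u v)

degree : ∀ {n} → Graph n → Fin n → ℕ
degree {n} G v = length (filter (λ u → Data.Bool._≟_ (adj G v u) true) (allFin n))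

Regular : ∀ {n} → Graph n → ℕ → Set
Regular G d = ∀ v → degree G v ≡ d

HasClique : ∀ {n} → ℕ → (Fin n → Fin n → Set) → Set
HasClique {n} s R =
  Σ (Fin s → Fin n) λ f → Injective _≡_ _≡_ f × (∀ i j → i ≢ j → R (f i) (f j))

ContainsK : ∀ {n} → ℕ → Graph n → Set
ContainsK s G = HasClique s (Adj G)

AdjPlus : ∀ {n} → Graph n → Fin n → Fin n → Fin n → Fin n → Set
AdjPlus G u v x y = Adj G x y ⊎ ((x ≡ u × y ≡ v) ⊎ (x ≡ v × y ≡ u))

KSaturated : ∀ {n} → ℕ → Graph n → Set
KSaturated s G =
  ¬ ContainsK s G ×
  (∀ u v → u ≢ v → ¬ Adj G u v → HasClique s (AdjPlus G u v))

{-# OPTIONS --safe #-}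
-- Call a graph clique-saturated with parameter p if its clique number is p and adding any
-- missing edge creates a K_{p+1}; in particular it is K_{p+1}-saturated.  Joins add these
-- parameters: a missing edge of G ∨ H lies inside G or inside H, and the new K_{p+1} there
-- extends by a K_q of the other side.  Joining regular graphs with the same co-degree n − d again
-- gives a regular graph of that co-degree.  The building blocks, all of co-degree 2k + 1, are the
-- empty graph on 2k + 1 vertices (p = 1) and three circulants Cay(ℤ_m, S) with m = 3k, 3k + 1,
-- 3k + 2 and |S| = k − 1, k, k + 1 (p = 2), where S is symmetric and sum-free (so the circulant is
-- triangle-free) and every other nonzero residue is a sum or a difference of two elements of S
-- (so any two non-adjacent vertices have a common neighbour).  Joining δ circulants with 3δk + r
-- vertices in total gives (i); adding the empty graph gives (ii).

module Submission where

open import Defs hiding (sym)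
open import Data.Bool using (Bool; true; false; T; if_then_else_)
import Data.Bool as Bool
open import Data.Empty using (⊥; ⊥-elim)
open import Data.Fin using (Fin; toℕ; fromℕ<; splitAt; _↑ˡ_; _↑ʳ_)
import Data.Fin as Fin
open import Data.Fin.Properties
  using (splitAt-↑ˡ; splitAt-↑ʳ; splitAt⁻¹-↑ˡ; splitAt⁻¹-↑ʳ; toℕ-fromℕ<; toℕ<n; toℕ-injective)
import Data.Fin.Properties as Finₚ
open import Data.List using (List; []; _∷_; _++_; length; filter; tabulate; lookup; drop)
import Data.List as List
open import Data.List.Properties using (length-tabulate; length-++; length-map)
open import Data.List.Membership.Propositional.Properties using (∈-lookup)
open import Data.List.Relation.Unary.All using (All)
import Data.List.Relation.Unary.All as All
import Data.List.Relation.Unary.All.Properties as All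
open import Data.List.Relation.Unary.AllPairs using (AllPairs)
import Data.List.Relation.Unary.AllPairs as AllPairs
import Data.List.Relation.Unary.AllPairs.Properties as AllPairs
open import Data.Nat
  using (ℕ; zero; suc; _+_; _*_; _≤_; _<_; _∸_; z≤n; s≤s; s≤s⁻¹; _≤?_; _<?_; _<ᵇ_; ∣_-_∣)
open import Data.Nat.Properties
open import Algebra.Properties.CommutativeSemigroup +-commutativeSemigroup
  using (interchange; x∙yz≈y∙xz; x∙yz≈z∙yx; x∙yz≈xz∙y; xy∙z≈xz∙y)
open import Data.Nat.Tactic.RingSolver using (solve; solve-∀)
open import Data.Product using (Σ; _×_; _,_)
open import Data.Sum using (_⊎_; inj₁; inj₂)
open import Data.Unit using (tt)
open import Function using (_∘_)
open import Function.Definitions using (Injective)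
open import Relation.Binary.Definitions using (Symmetric; Irreflexive)
open import Relation.Binary.PropositionalEquality
open import Relation.Nullary using (¬_; yes; no)

bit : Bool → ℕ
bit true  = 1
bit false = 0

count : (n : ℕ) → (Fin n → Bool) → ℕ
count zero    f = 0
count (suc n) f = bit (f Fin.zero) + count n (f ∘ Fin.suc)

length-filter-tabulate : ∀ {m n} (g : Fin m → Bool) (h : Fin n → Fin m) →
  length (filter (λ u → g u Bool.≟ true) (tabulate h)) ≡ count n (g ∘ h)
length-filter-tabulate {n = zero}  g h = refl
length-filter-tabulate {n = suc n} g h with g (h Fin.zero)
... | true  = cong suc (length-filter-tabulate g (h ∘ Fin.suc))
... | false = length-filter-tabulate g (h ∘ Fin.suc)

degree≡count : ∀ {n} (G : Graph n) v → degree G v ≡ count n (adj G v)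
degree≡count G v = length-filter-tabulate (adj G v) (λ i → i)

count-cong : ∀ n {f g : Fin n → Bool} → (∀ i → f i ≡ g i) → count n f ≡ count n g
count-cong zero    f≗g = refl
count-cong (suc n) f≗g = cong₂ _+_ (cong bit (f≗g Fin.zero)) (count-cong n (f≗g ∘ Fin.suc))

count-true : ∀ n {f : Fin n → Bool} → (∀ i → f i ≡ true) → count n f ≡ n
count-true zero    f≗true = refl
count-true (suc n) f≗true rewrite f≗true Fin.zero = cong suc (count-true n (f≗true ∘ Fin.suc))

count-false : ∀ n → count n (λ _ → false) ≡ 0
count-false zero    = refl
count-false (suc n) = count-false n

count-+ : ∀ m n (f : Fin (m + n) → Bool) →
  count (m + n) f ≡ count m (f ∘ (_↑ˡ n)) + count n (f ∘ (m ↑ʳ_))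
count-+ zero    n f = refl
count-+ (suc m) n f rewrite count-+ m n (f ∘ Fin.suc) = sym (+-assoc (bit (f Fin.zero)) _ _)

countFrom : ℕ → ℕ → (ℕ → Bool) → ℕ
countFrom s zero    h = 0
countFrom s (suc n) h = bit (h s) + countFrom (suc s) n h

count≡countFrom : ∀ n s (h : ℕ → Bool) → count n (λ i → h (s + toℕ i)) ≡ countFrom s n h
count≡countFrom zero    s h = refl
count≡countFrom (suc n) s h = cong₂ _+_ (cong (bit ∘ h) (+-identityʳ s))
  (trans (count-cong n (λ i → cong h (+-suc s (toℕ i)))) (count≡countFrom n (suc s) h))

countFrom-cong : ∀ s n {h h′ : ℕ → Bool} → (∀ i → i < n → h (s + i) ≡ h′ (s + i)) →
  countFrom s n h ≡ countFrom s n h′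
countFrom-cong s zero    h≗h′ = refl
countFrom-cong s (suc n) {h} {h′} h≗h′ = cong₂ _+_
  (cong bit (subst (λ x → h x ≡ h′ x) (+-identityʳ s) (h≗h′ 0 (s≤s z≤n))))
  (countFrom-cong (suc s) n λ i i<n → subst (λ x → h x ≡ h′ x) (+-suc s i) (h≗h′ (suc i) (s≤s i<n)))

countFrom-+ : ∀ s m n (h : ℕ → Bool) → countFrom s (m + n) h ≡ countFrom s m h + countFrom (s + m) n h
countFrom-+ s zero    n h = cong (λ x → countFrom x n h) (sym (+-identityʳ s))
countFrom-+ s (suc m) n h = begin
  bit (h s) + countFrom (suc s) (m + n) h                          ≡⟨ cong (bit (h s) +_) (countFrom-+ (suc s) m n h) ⟩
  bit (h s) + (countFrom (suc s) m h + countFrom (suc s + m) n h)  ≡⟨ +-assoc (bit (h s)) _ _ ⟨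
  countFrom s (suc m) h + countFrom (suc s + m) n h                ≡⟨ cong (λ x → countFrom s (suc m) h + countFrom x n h) (+-suc s m) ⟨
  countFrom s (suc m) h + countFrom (s + suc m) n h                ∎
  where open ≡-Reasoning

countFrom-shift : ∀ s n (h : ℕ → Bool) → countFrom s n h ≡ countFrom 0 n (λ i → h (s + i))
countFrom-shift s n h = trans (sym (count≡countFrom n s h)) (count≡countFrom n 0 (λ i → h (s + i)))

countFrom-const : ∀ s n {b} {h : ℕ → Bool} → (∀ i → i < n → h (s + i) ≡ b) → countFrom s n h ≡ n * bit b
countFrom-const s n {b} h≗b = trans (countFrom-cong s n h≗b) (go s n)
  where
  go : ∀ s n → countFrom s n (λ _ → b) ≡ n * bit b
  go s zero    = refl
  go s (suc n) = cong (bit b +_) (go (suc s) n)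

countFrom-reverse : ∀ n (h : ℕ → Bool) → countFrom 0 n (λ i → h (n ∸ i)) ≡ countFrom 1 n h
countFrom-reverse zero    h = refl
countFrom-reverse (suc n) h = begin
  bit (h (suc n)) + countFrom 1 n (λ i → h (suc n ∸ i)) ≡⟨ cong (bit (h (suc n)) +_) (countFrom-shift 1 n _) ⟩
  bit (h (suc n)) + countFrom 0 n (λ i → h (n ∸ i))     ≡⟨ cong (bit (h (suc n)) +_) (countFrom-reverse n h) ⟩
  bit (h (suc n)) + countFrom 1 n h                      ≡⟨ +-comm (bit (h (suc n))) _ ⟩
  countFrom 1 n h + bit (h (suc n))                      ≡⟨ cong (countFrom 1 n h +_) (+-identityʳ _) ⟨
  countFrom 1 n h + countFrom (1 + n) 1 h                ≡⟨ countFrom-+ 1 n 1 h ⟨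
  countFrom 1 (n + 1) h                                  ≡⟨ cong (λ x → countFrom 1 x h) (+-comm n 1) ⟩
  countFrom 1 (suc n) h                                  ∎
  where open ≡-Reasoning

Representable : (ℕ → Bool) → ℕ → Set
Representable S d = Σ ℕ λ s → (s ≤ d × T (S s) × T (S (d ∸ s))) ⊎ (T (S s) × T (S (s + d)))

-- S ⊆ {1, …, m − 1} is the connection set of a circulant on ℤ_m; by symmetry, `maximal` is
-- only needed for d ≤ m/2.
record ConnectionSet (m D : ℕ) : Set where
  field
    S         : ℕ → Bool
    positive  : ∀ t → T (S t) → 0 < t
    symmetric : ∀ t → T (S t) → Σ ℕ λ t′ → t + t′ ≡ m × T (S t′)
    sum-free  : ∀ s t → T (S s) → T (S t) → ¬ T (S (s + t))
    maximal   : ∀ d → 0 < d → d + d ≤ m → ¬ T (S d) → Representable S d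
    nonempty  : Σ ℕ λ s → T (S s)
    size      : countFrom 0 m S ≡ D

-- The set that, starting at 0, alternately skips g numbers and takes the next l, for (g , l) in turn.
inRuns : List (ℕ × ℕ) → ℕ → Bool
inRuns []             t = false
inRuns ((g , l) ∷ L) t = if t <ᵇ g then false else if t ∸ g <ᵇ l then true else inRuns L (t ∸ g ∸ l)

span : List (ℕ × ℕ) → ℕ
span []             = 0
span ((g , l) ∷ L) = g + l + span L

runLength : List (ℕ × ℕ) → ℕ
runLength []             = 0
runLength ((g , l) ∷ L) = l + runLength L

<ᵇ-false : ∀ {a b} → (a <ᵇ b) ≡ false → ¬ a < b
<ᵇ-false eq a<b = subst T eq (<⇒<ᵇ a<b)

<ᵇ-true : ∀ {a b} → (a <ᵇ b) ≡ true → a < b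
<ᵇ-true {a} {b} eq = <ᵇ⇒< a b (subst T (sym eq) tt)

inRuns-gap : ∀ g l L t → t < g → inRuns ((g , l) ∷ L) t ≡ false
inRuns-gap g l L t t<g with t <ᵇ g in eq
... | true  = refl
... | false = ⊥-elim (<ᵇ-false eq t<g)

inRuns-run : ∀ g l L u → u < l → inRuns ((g , l) ∷ L) (g + u) ≡ true
inRuns-run g l L u u<l with (g + u) <ᵇ g in eq
... | true  = ⊥-elim (m+n≮m g u (<ᵇ-true eq))
... | false rewrite m+n∸m≡n g u with u <ᵇ l in eq′
...   | true  = refl
...   | false = ⊥-elim (<ᵇ-false eq′ u<l)

inRuns-next : ∀ g l L u → inRuns ((g , l) ∷ L) (g + l + u) ≡ inRuns L u
inRuns-next g l L u with (g + l + u) <ᵇ g in eq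
... | true  = ⊥-elim (m+n≮m g (l + u) (subst (_< g) (+-assoc g l u) (<ᵇ-true eq)))
... | false rewrite +-assoc g l u | m+n∸m≡n g (l + u) with (l + u) <ᵇ l in eq′
...   | true  = ⊥-elim (m+n≮m l u (<ᵇ-true eq′))
...   | false rewrite m+n∸m≡n l u = refl

∈-run : ∀ g l L u → u < l → T (inRuns ((g , l) ∷ L) (g + u))
∈-run g l L u u<l = subst T (sym (inRuns-run g l L u u<l)) tt

∈-next : ∀ g l L u → T (inRuns L u) → T (inRuns ((g , l) ∷ L) (g + l + u))
∈-next g l L u = subst T (sym (inRuns-next g l L u))

private
  position : ∀ g l t → t < g ⊎ (Σ ℕ λ u → u < l × t ≡ g + u) ⊎ (Σ ℕ λ u → t ≡ g + l + u)
  position g l t with t <? g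
  ... | yes t<g = inj₁ t<g
  ... | no  t≮g with m≤n⇒∃[o]m+o≡n (≮⇒≥ t≮g)
  ...   | u , refl with u <? l
  ...     | yes u<l = inj₂ (inj₁ (u , u<l , refl))
  ...     | no  u≮l with m≤n⇒∃[o]m+o≡n (≮⇒≥ u≮l)
  ...       | v , refl = inj₂ (inj₂ (v , sym (+-assoc g l v)))

inRuns-∷⁻ : ∀ g l L t → T (inRuns ((g , l) ∷ L) t) →
  (Σ ℕ λ u → u < l × t ≡ g + u) ⊎ (Σ ℕ λ u → t ≡ g + l + u × T (inRuns L u))
inRuns-∷⁻ g l L t t∈ with position g l t
... | inj₁ t<g               = ⊥-elim (subst T (inRuns-gap g l L t t<g) t∈)
... | inj₂ (inj₁ in-run)     = inj₁ in-run
... | inj₂ (inj₂ (u , refl)) = inj₂ (u , refl , subst T (inRuns-next g l L u) t∈)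

inRuns-∷⁻-∉ : ∀ g l L t → ¬ T (inRuns ((g , l) ∷ L) t) →
  t < g ⊎ (Σ ℕ λ u → t ≡ g + l + u × ¬ T (inRuns L u))
inRuns-∷⁻-∉ g l L t t∉ with position g l t
... | inj₁ t<g                     = inj₁ t<g
... | inj₂ (inj₁ (u , u<l , refl)) = ⊥-elim (t∉ (∈-run g l L u u<l))
... | inj₂ (inj₂ (u , refl))       = inj₂ (u , refl , t∉ ∘ ∈-next g l L u)

countFrom-inRuns : ∀ L e → countFrom 0 (span L + e) (inRuns L) ≡ runLength L
countFrom-inRuns []             e = trans (countFrom-const 0 e {false} (λ _ _ → refl)) (*-zeroʳ e)
countFrom-inRuns ((g , l) ∷ L) e = begin
  countFrom 0 (g + l + span L + e) S
    ≡⟨ cong (λ x → countFrom 0 x S) (trans (+-assoc (g + l) (span L) e) (+-assoc g l n)) ⟩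
  countFrom 0 (g + (l + n)) S
    ≡⟨ trans (countFrom-+ 0 g _ S) (cong (countFrom 0 g S +_) (countFrom-+ g l n S)) ⟩
  countFrom 0 g S + (countFrom g l S + countFrom (g + l) n S)
    ≡⟨ cong₂ _+_ (countFrom-const 0 g (inRuns-gap g l L)) (cong₂ _+_ (countFrom-const g l (inRuns-run g l L)) rest) ⟩
  g * 0 + (l * 1 + countFrom 0 n (inRuns L))
    ≡⟨ cong₂ _+_ (*-zeroʳ g) (cong₂ _+_ (*-identityʳ l) (countFrom-inRuns L e)) ⟩
  l + runLength L
    ∎
  where
  open ≡-Reasoning
  S = inRuns ((g , l) ∷ L)
  n = span L + e
  rest : countFrom (g + l) n S ≡ countFrom 0 n (inRuns L)
  rest = trans (countFrom-shift (g + l) n S) (countFrom-cong 0 n (λ i _ → inRuns-next g l L i))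

≤-by : ∀ {a b} c → a + c ≡ b → a ≤ b
≤-by {a} c refl = m≤m+n a c

≤-absurd : ∀ {a b} → a ≤ b → ∀ c → suc c + b ≡ a → ⊥
≤-absurd {b = b} a≤b c refl = <⇒≱ (s≤s (m≤n+m b c)) a≤b

+-pair : ∀ a b j → a + j + (b + j) ≡ a + b + (j + j)
+-pair = solve-∀

+-shift : ∀ a b j → a + j + b ≡ a + b + j
+-shift = solve-∀

pair-lower : ∀ {a b s t} j → a + j ≤ s → b + j ≤ t → a + b + (j + j) ≤ s + t
pair-lower {a} {b} {s} {t} j a+j≤s b+j≤t = subst (_≤ s + t) (+-pair a b j) (+-mono-≤ a+j≤s b+j≤t)

-- {k − 1, k + 1} ∪ [k + 3, 2k − 3] ∪ {2k − 1, 2k + 1} ⊆ ℤ_3k, where k = 7 + j.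
module Connection₀ (j : ℕ) where

  runs : List (ℕ × ℕ)
  runs = (6 + j , 1) ∷ (1 , 1) ∷ (1 , 2 + j) ∷ (1 , 1) ∷ (1 , 1) ∷ []

  opaque
    S : ℕ → Bool
    S = inRuns runs

  S-cong : ∀ a b → a ≡ b → T (S a) → T (S b)
  S-cong _ _ = subst (T ∘ S)

  opaque
    unfolding S
    member : ∀ t → T (S t) →
      t ≡ 6 + j ⊎ t ≡ 8 + j ⊎ (Σ ℕ λ u → u < 2 + j × t ≡ 10 + j + u) ⊎
      t ≡ 13 + (j + j) ⊎ t ≡ 15 + (j + j)
    member t t∈S with inRuns-∷⁻ (6 + j) 1 (drop 1 runs) t t∈S
    ... | inj₁ (zero , _ , refl)    = inj₁ (+-identityʳ (6 + j))
    ... | inj₁ (suc _ , s≤s () , _)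
    ... | inj₂ (t₁ , refl , t₁∈) with inRuns-∷⁻ 1 1 (drop 2 runs) t₁ t₁∈
    ...   | inj₁ (zero , _ , refl)    = inj₂ (inj₁ (solve (j ∷ [])))
    ...   | inj₁ (suc _ , s≤s () , _)
    ...   | inj₂ (t₂ , refl , t₂∈) with inRuns-∷⁻ 1 (2 + j) (drop 3 runs) t₂ t₂∈
    ...     | inj₁ (u , u< , refl) = inj₂ (inj₂ (inj₁ (u , u< , solve (j ∷ u ∷ []))))
    ...     | inj₂ (t₃ , refl , t₃∈) with inRuns-∷⁻ 1 1 (drop 4 runs) t₃ t₃∈
    ...       | inj₁ (zero , _ , refl)    = inj₂ (inj₂ (inj₂ (inj₁ (solve (j ∷ [])))))
    ...       | inj₁ (suc _ , s≤s () , _)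
    ...       | inj₂ (t₄ , refl , t₄∈) with inRuns-∷⁻ 1 1 [] t₄ t₄∈
    ...         | inj₁ (zero , _ , refl)    = inj₂ (inj₂ (inj₂ (inj₂ (solve (j ∷ [])))))
    ...         | inj₁ (suc _ , s≤s () , _)
    ...         | inj₂ (_ , _ , ())

    non-member : ∀ d → ¬ T (S d) →
      d < 6 + j ⊎ d ≡ 7 + j ⊎ d ≡ 9 + j ⊎ d ≡ 12 + (j + j) ⊎ d ≡ 14 + (j + j) ⊎
      (Σ ℕ λ u → d ≡ 16 + (j + j) + u)
    non-member d d∉S with inRuns-∷⁻-∉ (6 + j) 1 (drop 1 runs) d d∉S
    ... | inj₁ d< = inj₁ d<
    ... | inj₂ (d₁ , refl , d₁∉) with inRuns-∷⁻-∉ 1 1 (drop 2 runs) d₁ d₁∉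
    ...   | inj₁ (s≤s z≤n) = inj₂ (inj₁ (solve (j ∷ [])))
    ...   | inj₂ (d₂ , refl , d₂∉) with inRuns-∷⁻-∉ 1 (2 + j) (drop 3 runs) d₂ d₂∉
    ...     | inj₁ (s≤s z≤n) = inj₂ (inj₂ (inj₁ (solve (j ∷ []))))
    ...     | inj₂ (d₃ , refl , d₃∉) with inRuns-∷⁻-∉ 1 1 (drop 4 runs) d₃ d₃∉
    ...       | inj₁ (s≤s z≤n) = inj₂ (inj₂ (inj₂ (inj₁ (solve (j ∷ [])))))
    ...       | inj₂ (d₄ , refl , d₄∉) with inRuns-∷⁻-∉ 1 1 [] d₄ d₄∉
    ...         | inj₁ (s≤s z≤n)       = inj₂ (inj₂ (inj₂ (inj₂ (inj₁ (solve (j ∷ []))))))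
    ...         | inj₂ (d₅ , refl , _) = inj₂ (inj₂ (inj₂ (inj₂ (inj₂ (d₅ , solve (j ∷ d₅ ∷ []))))))

    first : T (S (6 + j))
    first = S-cong (6 + j + 0) (6 + j) (+-identityʳ (6 + j)) (∈-run (6 + j) 1 (drop 1 runs) 0 (s≤s z≤n))

    second : T (S (8 + j))
    second = S-cong (6 + j + 1 + (1 + 0)) (8 + j) (solve (j ∷ []))
      (∈-next (6 + j) 1 (drop 1 runs) (1 + 0) (∈-run 1 1 (drop 2 runs) 0 (s≤s z≤n)))

    middle : ∀ u → u < 2 + j → T (S (10 + j + u))
    middle u u< = S-cong (6 + j + 1 + (1 + 1 + (1 + u))) (10 + j + u) (solve (j ∷ u ∷ []))
      (∈-next (6 + j) 1 (drop 1 runs) (1 + 1 + (1 + u))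
        (∈-next 1 1 (drop 2 runs) (1 + u) (∈-run 1 (2 + j) (drop 3 runs) u u<)))

    fourth : T (S (13 + (j + j)))
    fourth = S-cong (6 + j + 1 + (1 + 1 + (1 + (2 + j) + (1 + 0)))) (13 + (j + j)) (solve (j ∷ []))
      (∈-next (6 + j) 1 (drop 1 runs) (1 + 1 + (1 + (2 + j) + (1 + 0)))
        (∈-next 1 1 (drop 2 runs) (1 + (2 + j) + (1 + 0))
          (∈-next 1 (2 + j) (drop 3 runs) (1 + 0) (∈-run 1 1 (drop 4 runs) 0 (s≤s z≤n)))))

    last : T (S (15 + (j + j)))
    last = S-cong (6 + j + 1 + (1 + 1 + (1 + (2 + j) + (1 + 1 + (1 + 0))))) (15 + (j + j)) (solve (j ∷ []))
      (∈-next (6 + j) 1 (drop 1 runs) (1 + 1 + (1 + (2 + j) + (1 + 1 + (1 + 0))))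
        (∈-next 1 1 (drop 2 runs) (1 + (2 + j) + (1 + 1 + (1 + 0)))
          (∈-next 1 (2 + j) (drop 3 runs) (1 + 1 + (1 + 0))
            (∈-next 1 1 (drop 4 runs) (1 + 0) (∈-run 1 1 [] 0 (s≤s z≤n))))))

    size : countFrom 0 (3 * (7 + j)) S ≡ 6 + j
    size = subst₂ (λ n c → countFrom 0 n (inRuns runs) ≡ c) (span≡ j) (size≡ j) (countFrom-inRuns runs (5 + j))
      where
      span≡ : ∀ j → 6 + j + 1 + (1 + 1 + (1 + (2 + j) + (1 + 1 + (1 + 1 + 0)))) + (5 + j) ≡ 3 * (7 + j)
      span≡ = solve-∀
      size≡ : ∀ j → 1 + (1 + (2 + j + (1 + (1 + 0)))) ≡ 6 + j
      size≡ = solve-∀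

  category : ∀ t → T (S t) → t ≡ 6 + j ⊎ t ≡ 8 + j ⊎ 10 + j ≤ t
  category t t∈S with member t t∈S
  ... | inj₁ t≡                            = inj₁ t≡
  ... | inj₂ (inj₁ t≡)                     = inj₂ (inj₁ t≡)
  ... | inj₂ (inj₂ (inj₁ (u , _ , refl))) = inj₂ (inj₂ (m≤m+n (10 + j) u))
  ... | inj₂ (inj₂ (inj₂ (inj₁ refl)))    = inj₂ (inj₂ (≤-by (3 + j) (+-pair 10 3 j)))
  ... | inj₂ (inj₂ (inj₂ (inj₂ refl)))    = inj₂ (inj₂ (≤-by (5 + j) (+-pair 10 5 j)))

  at-least : ∀ t → T (S t) → t ≡ 6 + j ⊎ 8 + j ≤ t
  at-least t t∈S with category t t∈S
  ... | inj₁ t≡               = inj₁ t≡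
  ... | inj₂ (inj₁ refl)      = inj₂ ≤-refl
  ... | inj₂ (inj₂ 10+j≤t)    = inj₂ (≤-trans (m≤n+m (8 + j) 2) 10+j≤t)

  lower : ∀ t → T (S t) → 6 + j ≤ t
  lower t t∈S with at-least t t∈S
  ... | inj₁ refl  = ≤-refl
  ... | inj₂ 8+j≤t = ≤-trans (m≤n+m (6 + j) 2) 8+j≤t

  sum-lower : ∀ {s t} → T (S s) → T (S t) → 12 + (j + j) ≤ s + t
  sum-lower {s} {t} s∈S t∈S = pair-lower j (lower s s∈S) (lower t t∈S)

  middle-upper : ∀ u → u < 2 + j → 10 + j + u ≤ 11 + (j + j)
  middle-upper u u< = subst (10 + j + u ≤_) (+-pair 10 1 j) (+-monoʳ-≤ (10 + j) (s≤s⁻¹ u<))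

  first+last : ∀ j → 6 + j + (15 + (j + j)) ≡ 3 * (7 + j)
  first+last = solve-∀

  second+fourth : ∀ j → 8 + j + (13 + (j + j)) ≡ 3 * (7 + j)
  second+fourth = solve-∀

  middle+middle : ∀ u w → u + w ≡ 1 + j → 10 + j + u + (10 + j + w) ≡ 3 * (7 + j)
  middle+middle u w u+w≡ = begin
    10 + j + u + (10 + j + w) ≡⟨ rearrange j u w ⟩
    20 + (j + j) + (u + w)    ≡⟨ cong (20 + (j + j) +_) u+w≡ ⟩
    20 + (j + j) + (1 + j)    ≡⟨ total j ⟩
    3 * (7 + j)               ∎
    where
    open ≡-Reasoning
    rearrange : ∀ j u w → 10 + j + u + (10 + j + w) ≡ 20 + (j + j) + (u + w)
    rearrange = solve-∀
    total : ∀ j → 20 + (j + j) + (1 + j) ≡ 3 * (7 + j)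
    total = solve-∀

  too-far : ∀ d → 12 + (j + j) ≤ d → ¬ d + d ≤ 3 * (7 + j)
  too-far d 12+2j≤d 2d≤m = ≤-absurd (≤-trans (+-mono-≤ 12+2j≤d 12+2j≤d) 2d≤m) (2 + j) (excess j)
    where
    excess : ∀ j → suc (2 + j) + 3 * (7 + j) ≡ 12 + (j + j) + (12 + (j + j))
    excess = solve-∀

  representable-small : ∀ d → 0 < d → d < 6 + j → Representable S d
  representable-small 1 _ _ =
    10 + j , inj₂ (S-cong _ _ (+-identityʳ (10 + j)) (middle 0 (s≤s z≤n)) , middle 1 (s≤s (s≤s z≤n)))
  representable-small 2 _ _ =
    6 + j , inj₂ (first , S-cong _ _ (sym (+-shift 6 2 j)) second)
  representable-small 3 _ _ =
    8 + j , inj₂ (second , S-cong _ _ (trans (+-shift 10 1 j) (sym (+-shift 8 3 j))) (middle 1 (s≤s (s≤s z≤n))))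
  representable-small (suc (suc (suc (suc d)))) _ d< =
    6 + j , inj₂ (first , S-cong _ _ (sym (shift j d)) (middle d (s≤s⁻¹ (s≤s⁻¹ (s≤s⁻¹ (s≤s⁻¹ d<))))))
    where
    shift : ∀ j d → 6 + j + (4 + d) ≡ 10 + j + d
    shift = solve-∀

  connection₀ : ConnectionSet (3 * (7 + j)) (6 + j)
  connection₀ = record
    { S          = S
    ; positive   = λ t t∈S → ≤-trans (s≤s z≤n) (lower t t∈S)
    ; symmetric  = symmetric
    ; sum-free   = sum-free
    ; maximal    = maximal
    ; nonempty   = 6 + j , first
    ; size       = size
    }
    where
    symmetric : ∀ t → T (S t) → Σ ℕ λ t′ → t + t′ ≡ 3 * (7 + j) × T (S t′)
    symmetric t t∈S with member t t∈S
    ... | inj₁ refl                      = 15 + (j + j) , first+last j , last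
    ... | inj₂ (inj₁ refl)               = 13 + (j + j) , second+fourth j , fourth
    ... | inj₂ (inj₂ (inj₂ (inj₁ refl))) = 8 + j , trans (+-comm (13 + (j + j)) _) (second+fourth j) , second
    ... | inj₂ (inj₂ (inj₂ (inj₂ refl))) = 6 + j , trans (+-comm (15 + (j + j)) _) (first+last j) , first
    ... | inj₂ (inj₂ (inj₁ (u , s≤s u≤ , refl))) with m≤n⇒∃[o]m+o≡n u≤
    ...   | w , u+w≡ = 10 + j + w , middle+middle u w u+w≡ , middle w (s≤s (subst (w ≤_) u+w≡ (m≤n+m w u)))
    sum-free : ∀ s t → T (S s) → T (S t) → ¬ T (S (s + t))
    sum-free s t s∈S t∈S s+t∈S with member (s + t) s+t∈S
    ... | inj₁ s+t≡ = ≤-absurd (subst (12 + (j + j) ≤_) s+t≡ (sum-lower s∈S t∈S)) (5 + j) (+-pair 6 6 j)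
    ... | inj₂ (inj₁ s+t≡) =
      ≤-absurd (subst (12 + (j + j) ≤_) s+t≡ (sum-lower s∈S t∈S)) (3 + j) (+-pair 4 8 j)
    ... | inj₂ (inj₂ (inj₁ (u , u< , s+t≡))) =
      ≤-absurd (≤-trans (subst (12 + (j + j) ≤_) s+t≡ (sum-lower s∈S t∈S)) (middle-upper u u<)) 0 refl
    sum-free s t s∈S t∈S s+t∈S | inj₂ (inj₂ (inj₂ (inj₁ s+t≡))) with at-least s s∈S | at-least t t∈S
    ... | inj₁ refl | inj₁ refl  = ≤-absurd (≤-reflexive (sym s+t≡)) 0 (cong suc (+-pair 6 6 j))
    ... | inj₂ 8+j≤s | _         =
      ≤-absurd (subst (14 + (j + j) ≤_) s+t≡ (pair-lower j 8+j≤s (lower t t∈S))) 0 refl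
    ... | inj₁ refl | inj₂ 8+j≤t =
      ≤-absurd (subst (14 + (j + j) ≤_) s+t≡ (pair-lower j (lower s s∈S) 8+j≤t)) 0 refl
    sum-free s t s∈S t∈S s+t∈S | inj₂ (inj₂ (inj₂ (inj₂ s+t≡))) with category s s∈S | category t t∈S
    ... | inj₁ refl        | inj₁ refl        = ≤-absurd (≤-reflexive (sym s+t≡)) 2 (cong (3 +_) (+-pair 6 6 j))
    ... | inj₁ refl        | inj₂ (inj₁ refl) = ≤-absurd (≤-reflexive (sym s+t≡)) 0 (cong suc (+-pair 6 8 j))
    ... | inj₂ (inj₁ refl) | inj₁ refl        = ≤-absurd (≤-reflexive (sym s+t≡)) 0 (cong suc (+-pair 8 6 j))
    ... | inj₂ (inj₁ refl) | inj₂ (inj₁ refl) =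
      ≤-absurd (subst (_≤ 15 + (j + j)) (+-pair 8 8 j) (≤-reflexive s+t≡)) 0 refl
    ... | inj₂ (inj₂ 10+j≤s) | _ =
      ≤-absurd (subst (16 + (j + j) ≤_) s+t≡ (pair-lower j 10+j≤s (lower t t∈S))) 0 refl
    ... | inj₁ refl        | inj₂ (inj₂ 10+j≤t) =
      ≤-absurd (subst (16 + (j + j) ≤_) s+t≡ (pair-lower j (≤-refl {6 + j}) 10+j≤t)) 0 refl
    ... | inj₂ (inj₁ refl) | inj₂ (inj₂ 10+j≤t) =
      ≤-absurd (subst (18 + (j + j) ≤_) s+t≡ (pair-lower j (≤-refl {8 + j}) 10+j≤t)) 2 refl
    maximal : ∀ d → 0 < d → d + d ≤ 3 * (7 + j) → ¬ T (S d) → Representable S d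
    maximal d 0<d 2d≤m d∉S with non-member d d∉S
    ... | inj₁ d<                                 = representable-small d 0<d d<
    ... | inj₂ (inj₁ refl)                        = 8 + j , inj₂ (second , S-cong _ _ (sym (+-pair 8 7 j)) last)
    ... | inj₂ (inj₂ (inj₁ refl))                 = 6 + j , inj₂ (first , S-cong _ _ (sym (+-pair 6 9 j)) last)
    ... | inj₂ (inj₂ (inj₂ (inj₁ refl)))          = ⊥-elim (too-far d ≤-refl 2d≤m)
    ... | inj₂ (inj₂ (inj₂ (inj₂ (inj₁ refl))))   = ⊥-elim (too-far d (m≤n+m _ 2) 2d≤m)
    ... | inj₂ (inj₂ (inj₂ (inj₂ (inj₂ (u , refl))))) =
      ⊥-elim (too-far d (≤-trans (m≤n+m _ 4) (m≤m+n _ u)) 2d≤m)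

-- {k} ∪ [k + 2, 2k − 1] ∪ {2k + 1} ⊆ ℤ_(3k+1), where k = 7 + j.
module Connection₁ (j : ℕ) where

  runs : List (ℕ × ℕ)
  runs = (7 + j , 1) ∷ (1 , 5 + j) ∷ (1 , 1) ∷ []

  opaque
    S : ℕ → Bool
    S = inRuns runs

  S-cong : ∀ a b → a ≡ b → T (S a) → T (S b)
  S-cong _ _ = subst (T ∘ S)

  opaque
    unfolding S
    member : ∀ t → T (S t) → t ≡ 7 + j ⊎ (Σ ℕ λ u → u < 5 + j × t ≡ 9 + j + u) ⊎ t ≡ 15 + (j + j)
    member t t∈S with inRuns-∷⁻ (7 + j) 1 (drop 1 runs) t t∈S
    ... | inj₁ (zero , _ , refl)      = inj₁ (+-identityʳ (7 + j))
    ... | inj₁ (suc _ , s≤s () , _)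
    ... | inj₂ (t₁ , refl , t₁∈) with inRuns-∷⁻ 1 (5 + j) (drop 2 runs) t₁ t₁∈
    ...   | inj₁ (u , u< , refl) = inj₂ (inj₁ (u , u< , solve (j ∷ u ∷ [])))
    ...   | inj₂ (t₂ , refl , t₂∈) with inRuns-∷⁻ 1 1 [] t₂ t₂∈
    ...     | inj₁ (zero , _ , refl)    = inj₂ (inj₂ (solve (j ∷ [])))
    ...     | inj₁ (suc _ , s≤s () , _)
    ...     | inj₂ (_ , _ , ())

    non-member : ∀ d → ¬ T (S d) →
      d < 7 + j ⊎ d ≡ 8 + j ⊎ d ≡ 14 + (j + j) ⊎ (Σ ℕ λ u → d ≡ 16 + (j + j) + u)
    non-member d d∉S with inRuns-∷⁻-∉ (7 + j) 1 (drop 1 runs) d d∉S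
    ... | inj₁ d< = inj₁ d<
    ... | inj₂ (d₁ , refl , d₁∉) with inRuns-∷⁻-∉ 1 (5 + j) (drop 2 runs) d₁ d₁∉
    ...   | inj₁ (s≤s z≤n) = inj₂ (inj₁ (solve (j ∷ [])))
    ...   | inj₂ (d₂ , refl , d₂∉) with inRuns-∷⁻-∉ 1 1 [] d₂ d₂∉
    ...     | inj₁ (s≤s z≤n)       = inj₂ (inj₂ (inj₁ (solve (j ∷ []))))
    ...     | inj₂ (d₃ , refl , _) = inj₂ (inj₂ (inj₂ (d₃ , solve (j ∷ d₃ ∷ []))))

    first : T (S (7 + j))
    first = S-cong (7 + j + 0) (7 + j) (+-identityʳ (7 + j)) (∈-run (7 + j) 1 (drop 1 runs) 0 (s≤s z≤n))

    middle : ∀ u → u < 5 + j → T (S (9 + j + u))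
    middle u u< = S-cong (7 + j + 1 + (1 + u)) (9 + j + u) (solve (j ∷ u ∷ []))
      (∈-next (7 + j) 1 (drop 1 runs) (1 + u) (∈-run 1 (5 + j) (drop 2 runs) u u<))

    last : T (S (15 + (j + j)))
    last = S-cong (7 + j + 1 + (1 + (5 + j) + (1 + 0))) (15 + (j + j)) (solve (j ∷ []))
      (∈-next (7 + j) 1 (drop 1 runs) (1 + (5 + j) + (1 + 0))
        (∈-next 1 (5 + j) (drop 2 runs) (1 + 0) (∈-run 1 1 [] 0 (s≤s z≤n))))

    size : countFrom 0 (3 * (7 + j) + 1) S ≡ 7 + j
    size = subst₂ (λ n c → countFrom 0 n (inRuns runs) ≡ c) (span≡ j) (size≡ j) (countFrom-inRuns runs (6 + j))
      where
      span≡ : ∀ j → 7 + j + 1 + (1 + (5 + j) + (1 + 1 + 0)) + (6 + j) ≡ 3 * (7 + j) + 1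
      span≡ = solve-∀
      size≡ : ∀ j → 1 + (5 + j + (1 + 0)) ≡ 7 + j
      size≡ = solve-∀

  at-least : ∀ t → T (S t) → t ≡ 7 + j ⊎ 9 + j ≤ t
  at-least t t∈S with member t t∈S
  ... | inj₁ t≡                     = inj₁ t≡
  ... | inj₂ (inj₁ (u , _ , refl)) = inj₂ (m≤m+n (9 + j) u)
  ... | inj₂ (inj₂ refl)           = inj₂ (≤-by (6 + j) (+-pair 9 6 j))

  lower : ∀ t → T (S t) → 7 + j ≤ t
  lower t t∈S with at-least t t∈S
  ... | inj₁ refl  = ≤-refl
  ... | inj₂ 9+j≤t = ≤-trans (m≤n+m (7 + j) 2) 9+j≤t

  sum-lower : ∀ {s t} → T (S s) → T (S t) → 14 + (j + j) ≤ s + t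
  sum-lower {s} {t} s∈S t∈S = pair-lower j (lower s s∈S) (lower t t∈S)

  middle-upper : ∀ u → u < 5 + j → 9 + j + u ≤ 13 + (j + j)
  middle-upper u u< = subst (9 + j + u ≤_) (+-pair 9 4 j) (+-monoʳ-≤ (9 + j) (s≤s⁻¹ u<))

  first+last : ∀ j → 7 + j + (15 + (j + j)) ≡ 3 * (7 + j) + 1
  first+last = solve-∀

  middle+middle : ∀ u w → u + w ≡ 4 + j → 9 + j + u + (9 + j + w) ≡ 3 * (7 + j) + 1
  middle+middle u w u+w≡ = begin
    9 + j + u + (9 + j + w) ≡⟨ rearrange j u w ⟩
    18 + (j + j) + (u + w)  ≡⟨ cong (18 + (j + j) +_) u+w≡ ⟩
    18 + (j + j) + (4 + j)  ≡⟨ total j ⟩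
    3 * (7 + j) + 1         ∎
    where
    open ≡-Reasoning
    rearrange : ∀ j u w → 9 + j + u + (9 + j + w) ≡ 18 + (j + j) + (u + w)
    rearrange = solve-∀
    total : ∀ j → 18 + (j + j) + (4 + j) ≡ 3 * (7 + j) + 1
    total = solve-∀

  too-far : ∀ d → 14 + (j + j) ≤ d → ¬ d + d ≤ 3 * (7 + j) + 1
  too-far d 14+2j≤d 2d≤m = ≤-absurd (≤-trans (+-mono-≤ 14+2j≤d 14+2j≤d) 2d≤m) (5 + j) (excess j)
    where
    excess : ∀ j → suc (5 + j) + (3 * (7 + j) + 1) ≡ 14 + (j + j) + (14 + (j + j))
    excess = solve-∀

  representable-small : ∀ d → 0 < d → d < 7 + j → Representable S d
  representable-small 1 _ _ =
    9 + j , inj₂ (S-cong _ _ (+-identityʳ (9 + j)) (middle 0 (s≤s z≤n)) , middle 1 (s≤s (s≤s z≤n)))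
  representable-small (suc (suc d)) _ d< =
    7 + j , inj₂ (first , S-cong _ _ (sym (shift j d)) (middle d (s≤s⁻¹ (s≤s⁻¹ d<))))
    where
    shift : ∀ j d → 7 + j + (2 + d) ≡ 9 + j + d
    shift = solve-∀

  connection₁ : ConnectionSet (3 * (7 + j) + 1) (7 + j)
  connection₁ = record
    { S          = S
    ; positive   = λ t t∈S → ≤-trans (s≤s z≤n) (lower t t∈S)
    ; symmetric  = symmetric
    ; sum-free   = sum-free
    ; maximal    = maximal
    ; nonempty   = 7 + j , first
    ; size       = size
    }
    where
    symmetric : ∀ t → T (S t) → Σ ℕ λ t′ → t + t′ ≡ 3 * (7 + j) + 1 × T (S t′)
    symmetric t t∈S with member t t∈S
    ... | inj₁ refl        = 15 + (j + j) , first+last j , last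
    ... | inj₂ (inj₂ refl) = 7 + j , trans (+-comm (15 + (j + j)) _) (first+last j) , first
    ... | inj₂ (inj₁ (u , s≤s u≤ , refl)) with m≤n⇒∃[o]m+o≡n u≤
    ...   | w , u+w≡ = 9 + j + w , middle+middle u w u+w≡ , middle w (s≤s (subst (w ≤_) u+w≡ (m≤n+m w u)))
    sum-free : ∀ s t → T (S s) → T (S t) → ¬ T (S (s + t))
    sum-free s t s∈S t∈S s+t∈S with member (s + t) s+t∈S
    ... | inj₁ s+t≡ = ≤-absurd (subst (14 + (j + j) ≤_) s+t≡ (sum-lower s∈S t∈S)) (6 + j) (+-pair 7 7 j)
    ... | inj₂ (inj₁ (u , u< , s+t≡)) =
      ≤-absurd (≤-trans (subst (14 + (j + j) ≤_) s+t≡ (sum-lower s∈S t∈S)) (middle-upper u u<)) 0 refl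
    sum-free s t s∈S t∈S s+t∈S | inj₂ (inj₂ s+t≡) with at-least s s∈S | at-least t t∈S
    ... | inj₁ refl | inj₁ refl  = ≤-absurd (≤-reflexive (sym s+t≡)) 0 (cong suc (+-pair 7 7 j))
    ... | inj₂ 9+j≤s | _         =
      ≤-absurd (subst (16 + (j + j) ≤_) s+t≡ (pair-lower j 9+j≤s (lower t t∈S))) 0 refl
    ... | inj₁ refl | inj₂ 9+j≤t =
      ≤-absurd (subst (16 + (j + j) ≤_) s+t≡ (pair-lower j (≤-refl {7 + j}) 9+j≤t)) 0 refl
    maximal : ∀ d → 0 < d → d + d ≤ 3 * (7 + j) + 1 → ¬ T (S d) → Representable S d
    maximal d 0<d 2d≤m d∉S with non-member d d∉S
    ... | inj₁ d<                        = representable-small d 0<d d<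
    ... | inj₂ (inj₁ refl)               = 7 + j , inj₂ (first , S-cong _ _ (sym (+-pair 7 8 j)) last)
    ... | inj₂ (inj₂ (inj₁ refl))        = ⊥-elim (too-far d ≤-refl 2d≤m)
    ... | inj₂ (inj₂ (inj₂ (u , refl))) = ⊥-elim (too-far d (≤-trans (m≤n+m _ 2) (m≤m+n _ u)) 2d≤m)

-- The middle third [k + 1, 2k + 1] ⊆ ℤ_(3k+2).
module Connection₂ (k : ℕ) where

  runs : List (ℕ × ℕ)
  runs = (suc k , suc k) ∷ []

  S : ℕ → Bool
  S = inRuns runs

  member : ∀ t → T (S t) → Σ ℕ λ u → u ≤ k × t ≡ suc k + u
  member t t∈S with inRuns-∷⁻ (suc k) (suc k) [] t t∈S
  ... | inj₁ (u , s≤s u≤k , t≡) = u , u≤k , t≡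
  ... | inj₂ (_ , _ , ())

  member⁺ : ∀ u → u ≤ k → T (S (suc k + u))
  member⁺ u u≤k = ∈-run (suc k) (suc k) [] u (s≤s u≤k)

  below : ∀ t → T (S t) → t < suc k + suc k
  below t t∈S with member t t∈S
  ... | u , u≤k , refl = +-monoʳ-< (suc k) (s≤s u≤k)

  connection₂ : ConnectionSet (3 * k + 2) (suc k)
  connection₂ = record
    { S          = S
    ; positive   = positive
    ; symmetric  = symmetric
    ; sum-free   = sum-free
    ; maximal    = maximal
    ; nonempty   = suc k + 0 , member⁺ 0 z≤n
    ; size       = subst₂ (λ n c → countFrom 0 n S ≡ c) (whole k) (cong suc (+-identityʳ k)) (countFrom-inRuns runs k)
    }
    where
    whole : ∀ k → suc k + suc k + 0 + k ≡ 3 * k + 2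
    whole = solve-∀
    positive : ∀ t → T (S t) → 0 < t
    positive t t∈S with member t t∈S
    ... | u , _ , refl = s≤s z≤n
    symmetric : ∀ t → T (S t) → Σ ℕ λ t′ → t + t′ ≡ 3 * k + 2 × T (S t′)
    symmetric t t∈S with member t t∈S
    ... | u , u≤k , refl with m≤n⇒∃[o]m+o≡n u≤k
    ...   | w , refl = suc k + w , split u w , member⁺ w (m≤n+m w u)
      where
      split : ∀ u w → suc (u + w) + u + (suc (u + w) + w) ≡ 3 * (u + w) + 2
      split = solve-∀
    sum-free : ∀ s t → T (S s) → T (S t) → ¬ T (S (s + t))
    sum-free s t s∈S t∈S s+t∈S with member s s∈S | member t t∈S
    ... | u , _ , refl | v , _ , refl = m+n≮m (suc k + suc k) (u + v)
      (subst (_< suc k + suc k) (interchange (suc k) u (suc k) v) (below _ s+t∈S))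
    maximal : ∀ d → 0 < d → d + d ≤ 3 * k + 2 → ¬ T (S d) → Representable S d
    maximal d 0<d 2d≤m d∉S with inRuns-∷⁻-∉ (suc k) (suc k) [] d d∉S
    ... | inj₁ d≤k            =
      suc k , inj₂ (subst (T ∘ S) (+-identityʳ (suc k)) (member⁺ 0 z≤n) , member⁺ d (s≤s⁻¹ d≤k))
    ... | inj₂ (u , refl , _) = ⊥-elim (m+1+n≰m (3 * k + 2) (subst (_≤ 3 * k + 2) (too-large k u) 2d≤m))
      where
      too-large : ∀ k u → suc k + suc k + u + (suc k + suc k + u) ≡ 3 * k + 2 + suc (k + 1 + (u + u))
      too-large = solve-∀

-- Opened only here: overloading `[]` and `_∷_` makes the `solve` calls above very slow.
open import Data.List.Relation.Unary.All using ([]; _∷_)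
open import Data.List.Relation.Unary.AllPairs using ([]; _∷_)

Clique : ∀ {n} → ℕ → (Fin n → Fin n → Set) → Set
Clique {n} s R = Σ (List (Fin n)) λ xs → AllPairs R xs × length xs ≡ s

clique⇒hasClique : ∀ {n s} {R : Fin n → Fin n → Set} → Symmetric R → Irreflexive _≡_ R →
  Clique s R → HasClique s R
clique⇒hasClique {R = R} R-sym R-irr (xs , rs , refl) = lookup xs , injective , related xs rs
  where
  related : ∀ xs → AllPairs R xs → ∀ i j → i ≢ j → R (lookup xs i) (lookup xs j)
  related (x ∷ xs) (r ∷ rs) Fin.zero    Fin.zero    i≢j = ⊥-elim (i≢j refl)
  related (x ∷ xs) (r ∷ rs) Fin.zero    (Fin.suc j) _   = All.lookup r (∈-lookup j)
  related (x ∷ xs) (r ∷ rs) (Fin.suc i) Fin.zero    _   = R-sym (All.lookup r (∈-lookup i))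
  related (x ∷ xs) (r ∷ rs) (Fin.suc i) (Fin.suc j) i≢j = related xs rs i j (i≢j ∘ cong Fin.suc)
  injective : Injective _≡_ _≡_ (lookup xs)
  injective {i} {j} eq with i Finₚ.≟ j
  ... | yes i≡j = i≡j
  ... | no  i≢j = ⊥-elim (R-irr eq (related xs rs i j i≢j))

record CliqueSaturated {n} (p : ℕ) (G : Graph n) : Set where
  field
    clique-bound : ∀ xs → AllPairs (Adj G) xs → length xs ≤ p
    clique       : Clique p (Adj G)
    saturated    : ∀ u v → u ≢ v → ¬ Adj G u v → Clique (suc p) (AdjPlus G u v)
open CliqueSaturated

Adj-irrefl : ∀ {n} (G : Graph n) → Irreflexive _≡_ (Adj G)
Adj-irrefl G {x} refl = subst T (irrefl G x)

Adj-sym : ∀ {n} (G : Graph n) → Symmetric (Adj G)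
Adj-sym G {x} {y} = subst T (Graph.sym G x y)

AdjPlus-sym : ∀ {n} (G : Graph n) u v → Symmetric (AdjPlus G u v)
AdjPlus-sym G u v (inj₁ e)               = inj₁ (Adj-sym G e)
AdjPlus-sym G u v (inj₂ (inj₁ (p , q))) = inj₂ (inj₂ (q , p))
AdjPlus-sym G u v (inj₂ (inj₂ (p , q))) = inj₂ (inj₁ (q , p))

AdjPlus-irrefl : ∀ {n} (G : Graph n) {u v} → u ≢ v → Irreflexive _≡_ (AdjPlus G u v)
AdjPlus-irrefl G u≢v x≡y (inj₁ e)                   = Adj-irrefl G x≡y e
AdjPlus-irrefl G u≢v refl (inj₂ (inj₁ (refl , q))) = u≢v q
AdjPlus-irrefl G u≢v refl (inj₂ (inj₂ (refl , q))) = u≢v (sym q)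

cliqueSaturated⇒kSaturated : ∀ {n p} {G : Graph n} → CliqueSaturated p G → KSaturated (suc p) G
cliqueSaturated⇒kSaturated {p = p} {G} sat = no-clique , saturating
  where
  no-clique : ¬ ContainsK (suc p) G
  no-clique (f , _ , pw) =
    1+n≰n (subst (_≤ p) (length-tabulate f) (clique-bound sat _ (AllPairs.tabulate⁺ (pw _ _))))
  saturating : ∀ u v → u ≢ v → ¬ Adj G u v → HasClique (suc p) (AdjPlus G u v)
  saturating u v u≢v ¬uv =
    clique⇒hasClique (AdjPlus-sym G u v) (AdjPlus-irrefl G u≢v) (saturated sat u v u≢v ¬uv)

data SplitView (a b : ℕ) : Fin (a + b) → Set where
  left  : (u : Fin a) → SplitView a b (u ↑ˡ b)
  right : (u : Fin b) → SplitView a b (a ↑ʳ u)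

splitView : ∀ a {b} (x : Fin (a + b)) → SplitView a b x
splitView a {b} x with splitAt a x in eq
... | inj₁ u = subst (SplitView a b) (splitAt⁻¹-↑ˡ eq) (left u)
... | inj₂ u = subst (SplitView a b) (splitAt⁻¹-↑ʳ eq) (right u)

clique-join : ∀ {a b s t} {R : Fin (a + b) → Fin (a + b) → Set}
  {RA : Fin a → Fin a → Set} {RB : Fin b → Fin b → Set} →
  (∀ {u v} → RA u v → R (u ↑ˡ b) (v ↑ˡ b)) →
  (∀ {u v} → RB u v → R (a ↑ʳ u) (a ↑ʳ v)) →
  (∀ u v → R (u ↑ˡ b) (a ↑ʳ v)) →
  Clique s RA → Clique t RB → Clique (s + t) R
clique-join {a} {b} liftA liftB across (xs , pxs , refl) (ys , pys , refl) =
  List.map (_↑ˡ b) xs ++ List.map (a ↑ʳ_) ys ,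
  AllPairs.++⁺ (AllPairs.map⁺ (AllPairs.map liftA pxs)) (AllPairs.map⁺ (AllPairs.map liftB pys))
    (All.map⁺ (All.universal (λ u → All.map⁺ (All.universal (across u) ys)) xs)) ,
  trans (length-++ (List.map (_↑ˡ b) xs)) (cong₂ _+_ (length-map _ xs) (length-map _ ys))

module _ {a b : ℕ} (G : Graph a) (H : Graph b) where

  private
    sumAdj : Fin a ⊎ Fin b → Fin a ⊎ Fin b → Bool
    sumAdj (inj₁ u) (inj₁ v) = adj G u v
    sumAdj (inj₂ u) (inj₂ v) = adj H u v
    sumAdj (inj₁ u) (inj₂ v) = true
    sumAdj (inj₂ u) (inj₁ v) = true

    sumAdj-sym : ∀ x y → sumAdj x y ≡ sumAdj y x
    sumAdj-sym (inj₁ u) (inj₁ v) = Graph.sym G u v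
    sumAdj-sym (inj₂ u) (inj₂ v) = Graph.sym H u v
    sumAdj-sym (inj₁ u) (inj₂ v) = refl
    sumAdj-sym (inj₂ u) (inj₁ v) = refl

    sumAdj-irrefl : ∀ x → sumAdj x x ≡ false
    sumAdj-irrefl (inj₁ u) = irrefl G u
    sumAdj-irrefl (inj₂ u) = irrefl H u

  join : Graph (a + b)
  join = record
    { adj    = λ x y → sumAdj (splitAt a x) (splitAt a y)
    ; sym    = λ x y → sumAdj-sym (splitAt a x) (splitAt a y)
    ; irrefl = λ x → sumAdj-irrefl (splitAt a x)
    }

  adj-join-ˡˡ : ∀ u v → adj join (u ↑ˡ b) (v ↑ˡ b) ≡ adj G u v
  adj-join-ˡˡ u v rewrite splitAt-↑ˡ a u b | splitAt-↑ˡ a v b = refl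

  adj-join-ʳʳ : ∀ u v → adj join (a ↑ʳ u) (a ↑ʳ v) ≡ adj H u v
  adj-join-ʳʳ u v rewrite splitAt-↑ʳ a b u | splitAt-↑ʳ a b v = refl

  adj-join-ˡʳ : ∀ u v → adj join (u ↑ˡ b) (a ↑ʳ v) ≡ true
  adj-join-ˡʳ u v rewrite splitAt-↑ˡ a u b | splitAt-↑ʳ a b v = refl

  adj-join-ʳˡ : ∀ u v → adj join (a ↑ʳ u) (v ↑ˡ b) ≡ true
  adj-join-ʳˡ u v rewrite splitAt-↑ʳ a b u | splitAt-↑ˡ a v b = refl

  degree-join-ˡ : ∀ u → degree join (u ↑ˡ b) ≡ degree G u + b
  degree-join-ˡ u = begin
    degree join (u ↑ˡ b)                                  ≡⟨ degree≡count join (u ↑ˡ b) ⟩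
    count (a + b) (adj join (u ↑ˡ b))                     ≡⟨ count-+ a b _ ⟩
    count a (adj join (u ↑ˡ b) ∘ (_↑ˡ b)) + count b (adj join (u ↑ˡ b) ∘ (a ↑ʳ_))
      ≡⟨ cong₂ _+_ (count-cong a (adj-join-ˡˡ u)) (count-true b (adj-join-ˡʳ u)) ⟩
    count a (adj G u) + b                                  ≡⟨ cong (_+ b) (degree≡count G u) ⟨
    degree G u + b                                          ∎
    where open ≡-Reasoning

  degree-join-ʳ : ∀ u → degree join (a ↑ʳ u) ≡ degree H u + a
  degree-join-ʳ u = begin
    degree join (a ↑ʳ u)                                  ≡⟨ degree≡count join (a ↑ʳ u) ⟩
    count (a + b) (adj join (a ↑ʳ u))                     ≡⟨ count-+ a b _ ⟩
    count a (adj join (a ↑ʳ u) ∘ (_↑ˡ b)) + count b (adj join (a ↑ʳ u) ∘ (a ↑ʳ_))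
      ≡⟨ cong₂ _+_ (count-true a (adj-join-ʳˡ u)) (count-cong b (adj-join-ʳʳ u)) ⟩
    a + count b (adj H u)                                  ≡⟨ +-comm a _ ⟩
    count b (adj H u) + a                                  ≡⟨ cong (_+ a) (degree≡count H u) ⟨
    degree H u + a                                          ∎
    where open ≡-Reasoning

  regular-join : ∀ {dG dH} → Regular G dG → Regular H dH → dG + b ≡ dH + a → Regular join (dG + b)
  regular-join regG regH balanced x with splitView a x
  ... | left u  = trans (degree-join-ˡ u) (cong (_+ b) (regG u))
  ... | right u = trans (degree-join-ʳ u) (trans (cong (_+ a) (regH u)) (sym balanced))

  private
    lefts : List (Fin (a + b)) → List (Fin a)
    lefts []       = []
    lefts (x ∷ xs) with splitView a x
    ... | left u  = u ∷ lefts xs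
    ... | right _ = lefts xs

    rights : List (Fin (a + b)) → List (Fin b)
    rights []       = []
    rights (x ∷ xs) with splitView a x
    ... | left _  = rights xs
    ... | right u = u ∷ rights xs

    length-lefts+rights : ∀ xs → length xs ≡ length (lefts xs) + length (rights xs)
    length-lefts+rights []       = refl
    length-lefts+rights (x ∷ xs) with splitView a x
    ... | left _  = cong suc (length-lefts+rights xs)
    ... | right _ = trans (cong suc (length-lefts+rights xs)) (sym (+-suc _ _))

    all-lefts : ∀ {u} ys → All (Adj join (u ↑ˡ b)) ys → All (Adj G u) (lefts ys)
    all-lefts []       []         = []
    all-lefts (y ∷ ys) (uy ∷ uys) with splitView a y
    ... | left v  = subst T (adj-join-ˡˡ _ v) uy ∷ all-lefts ys uys
    ... | right _ = all-lefts ys uys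

    all-rights : ∀ {u} ys → All (Adj join (a ↑ʳ u)) ys → All (Adj H u) (rights ys)
    all-rights []       []         = []
    all-rights (y ∷ ys) (uy ∷ uys) with splitView a y
    ... | left _  = all-rights ys uys
    ... | right v = subst T (adj-join-ʳʳ _ v) uy ∷ all-rights ys uys

    allPairs-lefts : ∀ xs → AllPairs (Adj join) xs → AllPairs (Adj G) (lefts xs)
    allPairs-lefts []       []         = []
    allPairs-lefts (x ∷ xs) (px ∷ pxs) with splitView a x
    ... | left _  = all-lefts xs px ∷ allPairs-lefts xs pxs
    ... | right _ = allPairs-lefts xs pxs

    allPairs-rights : ∀ xs → AllPairs (Adj join) xs → AllPairs (Adj H) (rights xs)
    allPairs-rights []       []         = []
    allPairs-rights (x ∷ xs) (px ∷ pxs) with splitView a x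
    ... | left _  = allPairs-rights xs pxs
    ... | right _ = all-rights xs px ∷ allPairs-rights xs pxs

    Adj-join-ˡˡ : ∀ {u v} → Adj G u v → Adj join (u ↑ˡ b) (v ↑ˡ b)
    Adj-join-ˡˡ {u} {v} = subst T (sym (adj-join-ˡˡ u v))

    Adj-join-ʳʳ : ∀ {u v} → Adj H u v → Adj join (a ↑ʳ u) (a ↑ʳ v)
    Adj-join-ʳʳ {u} {v} = subst T (sym (adj-join-ʳʳ u v))

    Adj-join-ˡʳ : ∀ u v → Adj join (u ↑ˡ b) (a ↑ʳ v)
    Adj-join-ˡʳ u v = subst T (sym (adj-join-ˡʳ u v)) tt

    AdjPlus-join-ˡ : ∀ {u v x y} → AdjPlus G u v x y → AdjPlus join (u ↑ˡ b) (v ↑ˡ b) (x ↑ˡ b) (y ↑ˡ b)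
    AdjPlus-join-ˡ (inj₁ e)                = inj₁ (Adj-join-ˡˡ e)
    AdjPlus-join-ˡ (inj₂ (inj₁ (p , q))) = inj₂ (inj₁ (cong (_↑ˡ b) p , cong (_↑ˡ b) q))
    AdjPlus-join-ˡ (inj₂ (inj₂ (p , q))) = inj₂ (inj₂ (cong (_↑ˡ b) p , cong (_↑ˡ b) q))

    AdjPlus-join-ʳ : ∀ {u v x y} → AdjPlus H u v x y → AdjPlus join (a ↑ʳ u) (a ↑ʳ v) (a ↑ʳ x) (a ↑ʳ y)
    AdjPlus-join-ʳ (inj₁ e)                = inj₁ (Adj-join-ʳʳ e)
    AdjPlus-join-ʳ (inj₂ (inj₁ (p , q))) = inj₂ (inj₁ (cong (a ↑ʳ_) p , cong (a ↑ʳ_) q))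
    AdjPlus-join-ʳ (inj₂ (inj₂ (p , q))) = inj₂ (inj₂ (cong (a ↑ʳ_) p , cong (a ↑ʳ_) q))

  cliqueSaturated-join : ∀ {p q} → CliqueSaturated p G → CliqueSaturated q H → CliqueSaturated (p + q) join
  cliqueSaturated-join {p} {q} satG satH = record
    { clique-bound = λ xs pxs → subst (_≤ p + q) (sym (length-lefts+rights xs))
        (+-mono-≤ (clique-bound satG _ (allPairs-lefts xs pxs)) (clique-bound satH _ (allPairs-rights xs pxs)))
    ; clique    = clique-join Adj-join-ˡˡ Adj-join-ʳʳ Adj-join-ˡʳ (clique satG) (clique satH)
    ; saturated = saturating
    }
    where
    saturating : ∀ u v → u ≢ v → ¬ Adj join u v → Clique (suc (p + q)) (AdjPlus join u v)
    saturating u v u≢v ¬uv with splitView a u | splitView a v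
    ... | left u' | left v' =
      clique-join AdjPlus-join-ˡ (inj₁ ∘ Adj-join-ʳʳ) (λ x y → inj₁ (Adj-join-ˡʳ x y))
        (saturated satG u' v' (u≢v ∘ cong (_↑ˡ b)) (¬uv ∘ Adj-join-ˡˡ)) (clique satH)
    ... | right u' | right v' = subst (λ s → Clique s (AdjPlus join (a ↑ʳ u') (a ↑ʳ v'))) (+-suc p q)
      (clique-join (inj₁ ∘ Adj-join-ˡˡ) AdjPlus-join-ʳ (λ x y → inj₁ (Adj-join-ˡʳ x y))
        (clique satG) (saturated satH u' v' (u≢v ∘ cong (a ↑ʳ_)) (¬uv ∘ Adj-join-ʳʳ)))
    ... | left u' | right v' = ⊥-elim (¬uv (Adj-join-ˡʳ u' v'))
    ... | right u' | left v' = ⊥-elim (¬uv (Adj-sym join (Adj-join-ˡʳ v' u')))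

empty : ∀ n → Graph n
empty n = record { adj = λ _ _ → false ; sym = λ _ _ → refl ; irrefl = λ _ → refl }

regular-empty : ∀ n → Regular (empty n) 0
regular-empty n v = trans (degree≡count (empty n) v) (count-false n)

cliqueSaturated-empty : ∀ n → CliqueSaturated 1 (empty (suc n))
cliqueSaturated-empty n = record
  { clique-bound = bound
  ; clique       = Fin.zero ∷ [] , [] ∷ [] , refl
  ; saturated    = λ u v _ _ → u ∷ v ∷ [] , (inj₂ (inj₁ (refl , refl)) ∷ []) ∷ [] ∷ [] , refl
  }
  where
  bound : ∀ xs → AllPairs (Adj (empty (suc n))) xs → length xs ≤ 1
  bound []          _               = z≤n
  bound (_ ∷ [])    _               = s≤s z≤n
  bound (_ ∷ _ ∷ _) ((() ∷ _) ∷ _)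

-- The distances from x to the vertices below it are x, …, 1, which the symmetry of h turns into
-- m − x, …, m − 1; the distances to the vertices above are 0, …, m − x − 1.
countFrom-distance : ∀ m (h : ℕ → Bool) x → x < m → (∀ t → t ≤ m → h t ≡ h (m ∸ t)) →
  countFrom 0 m (λ y → h ∣ x - y ∣) ≡ countFrom 0 m h
countFrom-distance m h x x<m mirror = begin
  countFrom 0 m F                ≡⟨ cong (λ n → countFrom 0 n F) x+a≡m ⟨
  countFrom 0 (x + a) F          ≡⟨ countFrom-+ 0 x a F ⟩
  countFrom 0 x F + countFrom x a F ≡⟨ cong₂ _+_ below above ⟩
  countFrom a x h + countFrom 0 a h ≡⟨ +-comm (countFrom a x h) _ ⟩
  countFrom 0 a h + countFrom a x h ≡⟨ countFrom-+ 0 a x h ⟨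
  countFrom 0 (a + x) h          ≡⟨ cong (λ n → countFrom 0 n h) (trans (+-comm a x) x+a≡m) ⟩
  countFrom 0 m h                ∎
  where
  open ≡-Reasoning
  F = λ y → h ∣ x - y ∣
  a = m ∸ x
  x+a≡m : x + a ≡ m
  x+a≡m = m+[n∸m]≡n (<⇒≤ x<m)
  reflect : ∀ y → y < x → m ∸ (x ∸ y) ≡ a + y
  reflect y y<x with m≤n⇒∃[o]m+o≡n (<⇒≤ y<x)
  ... | c , refl = begin
    m ∸ (y + c ∸ y)   ≡⟨ cong (m ∸_) (m+n∸m≡n y c) ⟩
    m ∸ c             ≡⟨ cong (_∸ c) x+a≡m ⟨
    y + c + a ∸ c     ≡⟨ cong (_∸ c) (xy∙z≈xz∙y y c a) ⟩
    y + a + c ∸ c     ≡⟨ m+n∸n≡m (y + a) c ⟩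
    y + a             ≡⟨ +-comm y a ⟩
    a + y             ∎
  below : countFrom 0 x F ≡ countFrom a x h
  below = begin
    countFrom 0 x F                        ≡⟨ countFrom-cong 0 x (λ i i<x → cong h (m≤n⇒∣n-m∣≡n∸m (<⇒≤ i<x))) ⟩
    countFrom 0 x (λ y → h (x ∸ y))         ≡⟨ countFrom-reverse x h ⟩
    countFrom 1 x h                         ≡⟨ countFrom-cong 1 x (λ i i<x → mirror (suc i) (<⇒≤ (≤-<-trans i<x x<m))) ⟩
    countFrom 1 x (λ t → h (m ∸ t))         ≡⟨ countFrom-reverse x (λ t → h (m ∸ t)) ⟨
    countFrom 0 x (λ y → h (m ∸ (x ∸ y)))   ≡⟨ countFrom-cong 0 x (λ i i<x → cong h (reflect i i<x)) ⟩
    countFrom 0 x (λ y → h (a + y))         ≡⟨ countFrom-shift a x h ⟨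
    countFrom a x h                         ∎
  above : countFrom x a F ≡ countFrom 0 a h
  above = trans (countFrom-shift x a F) (countFrom-cong 0 a (λ i _ → cong h (∣m-m+n∣≡n x i)))

module Circulant {m D : ℕ} (C : ConnectionSet m D) where
  open ConnectionSet C

  S-cong : ∀ {a b} → a ≡ b → T (S a) → T (S b)
  S-cong = subst (T ∘ S)

  bounded : ∀ t → T (S t) → t < m
  bounded t t∈S with symmetric t t∈S
  ... | t′ , t+t′≡m , t′∈S = subst (t <_) t+t′≡m (m<m+n t (positive t′ t′∈S))

  complement : ∀ t t′ → t + t′ ≡ m → T (S t) → T (S t′)
  complement t t′ t+t′≡m t∈S with symmetric t t∈S
  ... | t″ , t+t″≡m , t″∈S = S-cong (+-cancelˡ-≡ t t″ t′ (trans t+t″≡m (sym t+t′≡m))) t″∈S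

  S-mirror : ∀ t → t ≤ m → S t ≡ S (m ∸ t)
  S-mirror t t≤m with S t in eq | S (m ∸ t) in eq′
  ... | true  | true  = refl
  ... | false | false = refl
  ... | true  | false = ⊥-elim (subst T eq′ (complement t (m ∸ t) (m+[n∸m]≡n t≤m) (subst T (sym eq) tt)))
  ... | false | true  = ⊥-elim (subst T eq (complement (m ∸ t) t (m∸n+n≡m t≤m) (subst T (sym eq′) tt)))

  S-zero : S 0 ≡ false
  S-zero with S 0 in eq
  ... | true  = ⊥-elim (<-irrefl refl (positive 0 (subst T (sym eq) _)))
  ... | false = refl

  circulant : Graph m
  circulant = record
    { adj    = λ x y → S ∣ toℕ x - toℕ y ∣
    ; sym    = λ x y → cong S (∣-∣-comm (toℕ x) (toℕ y))
    ; irrefl = λ x → trans (cong S (∣n-n∣≡0 (toℕ x))) S-zero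
    }

  regular-circulant : Regular circulant D
  regular-circulant x = begin
    degree circulant x                              ≡⟨ degree≡count circulant x ⟩
    count m (λ y → S ∣ toℕ x - 0 + toℕ y ∣)         ≡⟨ count≡countFrom m 0 (λ y → S ∣ toℕ x - y ∣) ⟩
    countFrom 0 m (λ y → S ∣ toℕ x - y ∣)           ≡⟨ countFrom-distance m S (toℕ x) (toℕ<n x) S-mirror ⟩
    countFrom 0 m S                                 ≡⟨ size ⟩
    D                                               ∎
    where open ≡-Reasoning

  representable : ∀ d → 0 < d → d < m → ¬ T (S d) → Representable S d
  representable d 0<d d<m d∉S with d + d ≤? m
  ... | yes 2d≤m = maximal d 0<d 2d≤m d∉S
  ... | no  2d≰m with m≤n⇒∃[o]m+o≡n (<⇒≤ d<m)
  ...   | d′ , d+d′≡m = reflect (maximal d′ 0<d′ 2d′≤m (d∉S ∘ complement d′ d (trans (+-comm d′ d) d+d′≡m)))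
    where
    d′<d : d′ < d
    d′<d = +-cancelˡ-< d d′ d (subst (_< d + d) (sym d+d′≡m) (≰⇒> 2d≰m))
    0<d′ : 0 < d′
    0<d′ = subst (0 <_) (trans (cong (_∸ d) (sym d+d′≡m)) (m+n∸m≡n d d′)) (m<n⇒0<n∸m d<m)
    2d′≤m : d′ + d′ ≤ m
    2d′≤m = ≤-trans (+-monoʳ-≤ d′ (<⇒≤ d′<d)) (≤-reflexive (trans (+-comm d′ d) d+d′≡m))
    below : ∀ {s} → T (S (s + d′)) → s < d
    below {s} s+d′∈S = +-cancelʳ-< d′ s d (subst (s + d′ <_) (sym d+d′≡m) (bounded _ s+d′∈S))
    reflect : Representable S d′ → Representable S d
    reflect (s , inj₁ (s≤d′ , s∈S , d′-s∈S)) with m≤n⇒∃[o]m+o≡n s≤d′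
    ... | e , refl = s , inj₂ (s∈S , complement e (s + d)
      (trans (x∙yz≈z∙yx e s d) d+d′≡m) (S-cong (m+n∸m≡n s e) d′-s∈S))
    reflect (s , inj₂ (s∈S , s+d′∈S)) with m≤n⇒∃[o]m+o≡n (<⇒≤ (below s+d′∈S))
    ... | e , refl = s , inj₁ (m≤m+n s e , s∈S , S-cong (sym (m+n∸m≡n s e))
      (complement (s + d′) e (trans (xy∙z≈xz∙y s d′ e) d+d′≡m) s+d′∈S))

  infix 4 _∼_
  record _∼_ (x y : ℕ) : Set where
    constructor near
    field distance∈S : T (S ∣ x - y ∣)
  open _∼_

  ∼-sym : ∀ {x y} → x ∼ y → y ∼ x
  ∼-sym {x} {y} (near x∼y) = near (S-cong (∣-∣-comm x y) x∼y)

  ∼-by : ∀ {x y} e → x + e ≡ y → T (S e) → x ∼ y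
  ∼-by {x} e refl e∈S = near (S-cong (sym (∣m-m+n∣≡n x e)) e∈S)

  ∼-distance : ∀ {x y} e → x + e ≡ y → x ∼ y → T (S e)
  ∼-distance {x} e refl (near x∼y) = S-cong (∣m-m+n∣≡n x e) x∼y

  -- Sum-freeness in ℕ suffices: a sorted triangle has distances b − a, c − b and their sum.
  no-triangle-sorted : ∀ {a b c} → a ≤ b → b ≤ c → a ∼ b → b ∼ c → a ∼ c → ⊥
  no-triangle-sorted a≤b b≤c ab bc ac with m≤n⇒∃[o]m+o≡n a≤b | m≤n⇒∃[o]m+o≡n b≤c
  ... | p , refl | q , refl = sum-free p q (∼-distance p refl ab) (∼-distance q refl bc)
    (∼-distance (p + q) (sym (+-assoc _ p q)) ac)

  no-triangle : ∀ x y z → x ∼ y → y ∼ z → x ∼ z → ⊥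
  no-triangle x y z xy yz xz with ≤-total x y | ≤-total y z | ≤-total x z
  ... | inj₁ x≤y | inj₁ y≤z | _        = no-triangle-sorted x≤y y≤z xy yz xz
  ... | inj₁ x≤y | inj₂ z≤y | inj₁ x≤z = no-triangle-sorted x≤z z≤y xz (∼-sym yz) xy
  ... | inj₁ x≤y | inj₂ z≤y | inj₂ z≤x = no-triangle-sorted z≤x x≤y (∼-sym xz) xy (∼-sym yz)
  ... | inj₂ y≤x | inj₁ y≤z | inj₁ x≤z = no-triangle-sorted y≤x x≤z (∼-sym xy) xz yz
  ... | inj₂ y≤x | inj₁ y≤z | inj₂ z≤x = no-triangle-sorted y≤z z≤x yz (∼-sym xz) (∼-sym xy)
  ... | inj₂ y≤x | inj₂ z≤y | _        = no-triangle-sorted z≤y y≤x (∼-sym yz) (∼-sym xy) (∼-sym xz)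

  common-neighbour⁺ : ∀ x d → 0 < d → x + d < m → ¬ x ∼ x + d →
    Σ ℕ λ z → z < m × x ∼ z × x + d ∼ z
  common-neighbour⁺ x d 0<d x+d<m x≁y
    with representable d 0<d (≤-<-trans (m≤n+m d x) x+d<m) (x≁y ∘ ∼-by d refl)
  ... | s , inj₁ (s≤d , s∈S , d-s∈S) =
    x + s , ≤-<-trans (+-monoʳ-≤ x s≤d) x+d<m , ∼-by s refl s∈S ,
    ∼-sym (∼-by (d ∸ s) (trans (+-assoc x s _) (cong (x +_) (m+[n∸m]≡n s≤d))) d-s∈S)
  ... | s , inj₂ (s∈S , s+d∈S) with x + d + s <? m
  ...   | yes z<m = x + d + s , z<m , ∼-by (s + d) (x∙yz≈xz∙y x s d) s+d∈S , ∼-by s refl s∈S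
  -- Past m: z = x + d + s − m is at distance m − (s + d) from x and m − s from x + d.
  ...   | no  z≮m with m≤n⇒∃[o]m+o≡n (≮⇒≥ z≮m) | m≤n⇒∃[o]m+o≡n (<⇒≤ (bounded _ s+d∈S))
  ...     | z , m+z≡y+s | c , s+d+c≡m = z , ≤-<-trans z≤x (≤-<-trans (m≤m+n x d) x+d<m) ,
    ∼-sym (∼-by c z+c≡x (complement (s + d) c s+d+c≡m s+d∈S)) ,
    ∼-sym (∼-by (c + d) (trans (sym (+-assoc z c d)) (cong (_+ d) z+c≡x))
      (complement s (c + d) (trans (x∙yz≈xz∙y s c d) s+d+c≡m) s∈S))
    where
    z+c≡x : z + c ≡ x
    z+c≡x = +-cancelʳ-≡ (s + d) _ _ (begin
      z + c + (s + d)   ≡⟨ xy∙z≈xz∙y z c (s + d) ⟩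
      z + (s + d) + c   ≡⟨ +-assoc z (s + d) c ⟩
      z + (s + d + c)   ≡⟨ cong (z +_) s+d+c≡m ⟩
      z + m             ≡⟨ +-comm z m ⟩
      m + z             ≡⟨ m+z≡y+s ⟩
      x + d + s         ≡⟨ x∙yz≈xz∙y x s d ⟨
      x + (s + d)       ∎)
      where open ≡-Reasoning
    z≤x : z ≤ x
    z≤x = subst (z ≤_) z+c≡x (m≤m+n z c)

  common-neighbour≤ : ∀ {x y} → x ≤ y → y < m → x ≢ y → ¬ x ∼ y → Σ ℕ λ z → z < m × x ∼ z × y ∼ z
  common-neighbour≤ x≤y y<m x≢y x≁y with m≤n⇒∃[o]m+o≡n x≤y
  ... | zero  , refl = ⊥-elim (x≢y (sym (+-identityʳ _)))
  ... | suc d , refl = common-neighbour⁺ _ (suc d) (s≤s z≤n) y<m x≁y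

  common-neighbour : ∀ x y → x < m → y < m → x ≢ y → ¬ x ∼ y → Σ ℕ λ z → z < m × x ∼ z × y ∼ z
  common-neighbour x y x<m y<m x≢y x≁y with ≤-total x y
  ... | inj₁ x≤y = common-neighbour≤ x≤y y<m x≢y x≁y
  ... | inj₂ y≤x with common-neighbour≤ y≤x x<m (x≢y ∘ sym) (x≁y ∘ ∼-sym)
  ...   | z , z<m , y∼z , x∼z = z , z<m , x∼z , y∼z

  ∼-fromℕ< : ∀ {x y} (x<m : x < m) (y<m : y < m) → x ∼ y → toℕ (fromℕ< x<m) ∼ toℕ (fromℕ< y<m)
  ∼-fromℕ< x<m y<m = subst₂ _∼_ (sym (toℕ-fromℕ< x<m)) (sym (toℕ-fromℕ< y<m))

  cliqueSaturated-circulant : CliqueSaturated 2 circulant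
  cliqueSaturated-circulant = record
    { clique-bound = bound
    ; clique       = edge nonempty
    ; saturated    = saturating
    }
    where
    bound : ∀ xs → AllPairs (Adj circulant) xs → length xs ≤ 2
    bound []              _ = z≤n
    bound (_ ∷ [])        _ = s≤s z≤n
    bound (_ ∷ _ ∷ [])    _ = s≤s (s≤s z≤n)
    bound (x ∷ y ∷ z ∷ _) ((xy ∷ xz ∷ _) ∷ (yz ∷ _) ∷ _) =
      ⊥-elim (no-triangle (toℕ x) (toℕ y) (toℕ z) (near xy) (near yz) (near xz))
    edge : Σ ℕ (λ s → T (S s)) → Clique 2 (Adj circulant)
    edge (s , s∈S) = fromℕ< 0<m ∷ fromℕ< s<m ∷ [] ,
      (distance∈S (∼-fromℕ< 0<m s<m (∼-by s refl s∈S)) ∷ []) ∷ [] ∷ [] , refl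
      where
      s<m = bounded s s∈S
      0<m = ≤-<-trans z≤n s<m
    saturating : ∀ u v → u ≢ v → ¬ Adj circulant u v → Clique 3 (AdjPlus circulant u v)
    saturating u v u≢v ¬uv
      with common-neighbour (toℕ u) (toℕ v) (toℕ<n u) (toℕ<n v) (u≢v ∘ toℕ-injective) (¬uv ∘ distance∈S)
    ... | z , z<m , u∼z , v∼z = u ∷ v ∷ fromℕ< z<m ∷ [] ,
      (inj₂ (inj₁ (refl , refl)) ∷ inj₁ (to-fromℕ< u∼z) ∷ []) ∷
      (inj₁ (to-fromℕ< v∼z) ∷ []) ∷ [] ∷ [] , refl
      where
      to-fromℕ< : ∀ {x} → toℕ x ∼ z → Adj circulant x (fromℕ< z<m)
      to-fromℕ< = distance∈S ∘ subst (_ ∼_) (sym (toℕ-fromℕ< z<m))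

-- c is the co-degree n − deg, which joins of blocks preserve.
record Block (c p n : ℕ) : Set where
  constructor block
  field
    graph      : Graph n
    saturation : CliqueSaturated p graph
    deg        : ℕ
    regular    : Regular graph deg
    codegree   : deg + c ≡ n

join-block : ∀ {c p q a b} → Block c p a → Block c q b → Block c (p + q) (a + b)
join-block {c} (block G satG dG regG refl) (block H satH dH regH refl) =
  block (join G H) (cliqueSaturated-join G H satG satH) (dG + (dH + c))
    (regular-join G H regG regH (x∙yz≈y∙xz dG dH c)) (xy∙z≈xz∙y dG (dH + c) c)

empty-block : ∀ c → Block (suc c) 1 (suc c)
empty-block c = block (empty (suc c)) (cliqueSaturated-empty c) 0 (regular-empty (suc c)) refl

circulant-block : ∀ {c m D} (C : ConnectionSet m D) → D + c ≡ m → Block c 2 m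
circulant-block C D+c≡m = block circulant cliqueSaturated-circulant _ regular-circulant D+c≡m
  where open Circulant C

-- k ≥ 7 makes the run [k + 3, 2k − 3] of Connection₀ contain two consecutive numbers.
module _ (j : ℕ) where

  private
    k = 7 + j

  piece : ∀ r → r ≤ 2 → Block (suc (2 * k)) 2 (3 * k + r)
  piece 0 _ =
    subst (Block _ 2) (sym (+-identityʳ (3 * k))) (circulant-block (Connection₀.connection₀ j) (codegree₀ j))
    where
    codegree₀ : ∀ j → 6 + j + suc (2 * (7 + j)) ≡ 3 * (7 + j)
    codegree₀ = solve-∀
  piece 1 _ = circulant-block (Connection₁.connection₁ j) (codegree₁ j)
    where
    codegree₁ : ∀ j → 7 + j + suc (2 * (7 + j)) ≡ 3 * (7 + j) + 1
    codegree₁ = solve-∀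
  piece 2 _ = circulant-block (Connection₂.connection₂ k) (codegree₂ k)
    where
    codegree₂ : ∀ k → suc k + suc (2 * k) ≡ 3 * k + 2
    codegree₂ = solve-∀
  piece (suc (suc (suc _))) (s≤s (s≤s ()))

  extend : ∀ δ a b → Block (suc (2 * k)) 2 (3 * k + a) → Block (suc (2 * k)) (2 * suc δ) (3 * suc δ * k + b) →
    Block (suc (2 * k)) (2 * suc (suc δ)) (3 * suc (suc δ) * k + (a + b))
  extend δ a b B B′ = subst₂ (Block _) (cliques δ) (vertices δ k a b) (join-block B B′)
    where
    cliques : ∀ δ → 2 + 2 * suc δ ≡ 2 * suc (suc δ)
    cliques = solve-∀
    vertices : ∀ δ k a b → 3 * k + a + (3 * suc δ * k + b) ≡ 3 * suc (suc δ) * k + (a + b)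
    vertices = solve-∀

  joined-pieces : ∀ δ r → r ≤ 2 * suc δ → Block (suc (2 * k)) (2 * suc δ) (3 * suc δ * k + r)
  joined-pieces zero          r             r≤2   = piece r r≤2
  joined-pieces (suc δ)       0             _     = extend δ 0 0 (piece 0 z≤n) (joined-pieces δ 0 z≤n)
  joined-pieces (suc δ)       1             _     = extend δ 1 0 (piece 1 (s≤s z≤n)) (joined-pieces δ 0 z≤n)
  joined-pieces (suc δ)       (suc (suc r)) r+2≤  = extend δ 2 r (piece 2 ≤-refl) (joined-pieces δ r (r≤ δ r r+2≤))
    where
    r≤ : ∀ δ r → 2 + r ≤ 2 * suc (suc δ) → r ≤ 2 * suc δ
    r≤ δ r le = s≤s⁻¹ (s≤s⁻¹ (subst (2 + r ≤_) (two δ) le))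
      where
      two : ∀ δ → 2 * suc (suc δ) ≡ 2 + 2 * suc δ
      two = solve-∀

odd-degree : ∀ δ k r d → d + suc (2 * k) ≡ 3 * suc δ * k + r → d + 1 ≡ (3 * suc δ ∸ 2) * k + r
odd-degree δ k r d d+c≡n = +-cancelʳ-≡ (2 * k) (d + 1) _ (begin
  d + 1 + 2 * k                        ≡⟨ +-suc-right d k ⟩
  d + suc (2 * k)                      ≡⟨ d+c≡n ⟩
  3 * suc δ * k + r                    ≡⟨ split δ k r ⟩
  suc (3 * δ) * k + r + 2 * k          ≡⟨ cong (λ x → x * k + r + 2 * k) (sym 3[1+δ]∸2) ⟩
  (3 * suc δ ∸ 2) * k + r + 2 * k      ∎)
  where
  open ≡-Reasoning
  +-suc-right : ∀ d k → d + 1 + 2 * k ≡ d + suc (2 * k)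
  +-suc-right = solve-∀
  split : ∀ δ k r → 3 * suc δ * k + r ≡ suc (3 * δ) * k + r + 2 * k
  split = solve-∀
  3[1+δ]≡2+[1+3δ] : ∀ δ → 3 * suc δ ≡ 2 + suc (3 * δ)
  3[1+δ]≡2+[1+3δ] = solve-∀
  3[1+δ]∸2 : 3 * suc δ ∸ 2 ≡ suc (3 * δ)
  3[1+δ]∸2 = trans (cong (_∸ 2) (3[1+δ]≡2+[1+3δ] δ)) (m+n∸m≡n 2 _)

odd-cliques : ∀ δ k → 7 ≤ k → (r : ℕ) → r ≤ 2 * suc δ →
  Σ (Graph (3 * suc δ * k + r)) λ G → Σ ℕ λ d →
    KSaturated (2 * suc δ + 1) G × Regular G d × d + 1 ≡ (3 * suc δ ∸ 2) * k + r
odd-cliques δ k 7≤k r r≤ with m≤n⇒∃[o]m+o≡n 7≤k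
... | j , refl with joined-pieces j δ r r≤
...   | block G sat d reg d+c≡n =
  G , d , subst (λ s → KSaturated s G) (+-comm 1 (2 * suc δ)) (cliqueSaturated⇒kSaturated sat) , reg ,
  odd-degree δ k r d d+c≡n

even-cliques : ∀ δ k → 7 ≤ k → (r : ℕ) → 1 ≤ r → r ≤ 2 * suc δ + 1 →
  Σ (Graph ((3 * suc δ + 2) * k + r)) λ G → KSaturated (2 * suc δ + 2) G × Regular G (3 * suc δ * k + (r ∸ 1))
even-cliques δ k 7≤k (suc r) _ r<
  with m≤n⇒∃[o]m+o≡n 7≤k
... | j , refl
  with join-block (joined-pieces j δ r (s≤s⁻¹ (subst (suc r ≤_) (+-comm (2 * suc δ) 1) r<))) (empty-block (2 * k))
...   | block G sat d reg d+c≡n =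
  subst (λ n → Σ (Graph n) λ G → KSaturated (2 * suc δ + 2) G × Regular G (3 * suc δ * k + r)) (vertices δ k r)
    (G , subst (λ s → KSaturated s G) (sym (+-suc (2 * suc δ) 1)) (cliqueSaturated⇒kSaturated sat) ,
     subst (Regular G) (+-cancelʳ-≡ (suc (2 * k)) d _ d+c≡n) reg)
  where
  vertices : ∀ δ k r → 3 * suc δ * k + r + suc (2 * k) ≡ (3 * suc δ + 2) * k + suc r
  vertices = solve-∀

theorem1p2 : (δ : ℕ) → 1 ≤ δ →
    Σ ℕ λ kδ → (k : ℕ) → kδ ≤ k →
      ((r : ℕ) → r ≤ 2 * δ →
        Σ (Graph (3 * δ * k + r)) λ G → Σ ℕ λ d →
          KSaturated (2 * δ + 1) G × Regular G d ×
          d + 1 ≡ (3 * δ ∸ 2) * k + r)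
      ×
      ((r : ℕ) → 1 ≤ r → r ≤ 2 * δ + 1 →
        Σ (Graph ((3 * δ + 2) * k + r)) λ G →
          KSaturated (2 * δ + 2) G × Regular G (3 * δ * k + (r ∸ 1)))
theorem1p2 (suc δ) _ = 7 , λ k 7≤k → odd-cliques δ k 7≤k , even-cliques δ k 7≤k
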